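{- Let $\varepsilon$ be a system of equations as described, let $\varepsilon_i$ be an entry of the form $u_i\cdot v_i=w_i$, and let $\mathcal{M}$ be a well-prepared finite structure satisfying $\varphi^i_{\mathrm{link}}:=\forall y\,(A_{w_i}(y)\to\exists x\,M_i(x,y))\wedge\forall x\forall y\,(M_i(x,y)\to(A_{u_i}(x)\wedge A_{w_i}(y)))$. Then: (i) $\mathcal{M}\models\forall x\,\big(A_{u_i}(x)\to\exists^{=50\%}y\,([S_i(y)\wedge\neg M_i(x,y)]\vee A_{v_i}(y))\big)$ if and only if every element satisfying $A_{u_i}$ is connected via $M_i$ to exactly $|A_{v_i}^{\mathcal{M}}|$ elements satisfying $A_{w_i}$; (ii) $\mathcal{M}\models\forall x\,\big(A_{w_i}(x)\to\exists^{=50\%}y\,([S_i(y)\wedge x\neq y]\vee M_i(y,x))\big)$ if and only if the relation $M_i^{\mathcal{M}}$ (linking elements satisfying $A_{u_i}$ with elements satisfying $A_{w_i}$) is backward-functional, i.e. every element has at most one $M_i$-predecessor.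
   Context: A system $\varepsilon$ consists of entries $\varepsilon_1,\dots,\varepsilon_m$, each of one of the forms $u=1$, $u=v+w$ or $u=v\cdot w$ (written $u_i+v_i=w_i$ resp. $u_i\cdot v_i=w_i$ for three-variable entries), with pairwise distinct variables in each entry; $\mathrm{Var}(\varepsilon)$ is the set of variables occurring. The signature contains unary predicates $A_u$ ($u\in\mathrm{Var}(\varepsilon)$), unary predicates $F_i,S_i$ and a binary predicate $M_i$ for each $i$. A finite structure $\mathcal{M}$ (domain $M$) is well-prepared if: (1) no element satisfies $A_u$ and $A_v$ for distinct $u,v$; (2) for each entry $u_i=1$, exactly one element satisfies $A_{u_i}$; (3) for each entry of form $u_i+v_i=w_i$ or $u_i\cdot v_i=w_i$: every element satisfies exactly one of $F_i,S_i$, exactly half of the elements satisfy $F_i$, elements satisfying $A_{u_i}$ or $A_{v_i}$ satisfy $F_i$, and elements satisfying $A_{w_i}$ satisfy $S_i$. The formula $\exists^{=50\%}y\,\psi(x,y)$ holds at $x/a$ iff exactly $\frac12|M|$ elements $b$ satisfy $\psi(a,b)$. -}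

module Defs where

open import Data.Nat using (ℕ; zero; suc; _+_; _*_)
open import Data.Bool using (Bool; true; false; if_then_else_; _∧_; _∨_; not; T)
open import Data.Fin using (Fin; zero; suc; _≟_)
open import Data.Product using (Σ; ∃; _×_; _,_)
open import Data.Sum using (_⊎_)
open import Data.Unit using (⊤)
open import Relation.Nullary using (¬_)
open import Relation.Nullary.Decidable using (⌊_⌋)
open import Relation.Binary.PropositionalEquality using (_≡_; _≢_)

Var : Set
Var = ℕ

-- Entries of a system:  one u  :  u = 1
--                       add u v w :  u + v = w
--                       mul u v w :  u · v = w
data Entry : Set where
  one : Var → Entry
  add : Var → Var → Var → Entry
  mul : Var → Var → Var → Entry

EntryDistinct : Entry → Set
EntryDistinct (one u) = ⊤
EntryDistinct (add u v w) = u ≢ v × u ≢ w × v ≢ w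
EntryDistinct (mul u v w) = u ≢ v × u ≢ w × v ≢ w

record System (m : ℕ) : Set where
  field
    entry    : Fin m → Entry
    distinct : ∀ i → EntryDistinct (entry i)
open System public

data OccursIn (u : Var) : Entry → Set where
  one₁ : OccursIn u (one u)
  add₁ : ∀ {v w} → OccursIn u (add u v w)
  add₂ : ∀ {v w} → OccursIn u (add v u w)
  add₃ : ∀ {v w} → OccursIn u (add v w u)
  mul₁ : ∀ {v w} → OccursIn u (mul u v w)
  mul₂ : ∀ {v w} → OccursIn u (mul v u w)
  mul₃ : ∀ {v w} → OccursIn u (mul v w u)

_∈Var_ : ∀ {m} → Var → System m → Set
u ∈Var ε = ∃ λ i → OccursIn u (entry ε i)

IsBinEntry : Entry → Var → Var → Var → Set
IsBinEntry e u v w = (e ≡ add u v w) ⊎ (e ≡ mul u v w)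

-- Finite structures over the signature {A_u, F_i, S_i, M_i}, domain Fin n.
-- A_u is given for every variable name; only u ∈ Var(ε) are relevant.
record Structure (m n : ℕ) : Set where
  field
    A : Var → Fin n → Bool
    F : Fin m → Fin n → Bool
    S : Fin m → Fin n → Bool
    M : Fin m → Fin n → Fin n → Bool
open Structure public

count : ∀ {n} → (Fin n → Bool) → ℕ
count {zero}  p = 0
count {suc n} p = (if p zero then 1 else 0) + count (λ x → p (suc x))

-- ∃^{=50%} y ψ(y) : exactly half of the n elements satisfy ψ
Half : ∀ {n} → (Fin n → Bool) → Set
Half {n} ψ = 2 * count ψ ≡ n

_==_ : ∀ {n} → Fin n → Fin n → Bool
x == y = ⌊ x ≟ y ⌋

record WellPrepared {m n : ℕ} (ε : System m) (𝓜 : Structure m n) : Set where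
  field
    disjoint : ∀ u v → u ∈Var ε → v ∈Var ε → u ≢ v →
               ∀ x → ¬ (T (A 𝓜 u x) × T (A 𝓜 v x))
    unique   : ∀ i u → entry ε i ≡ one u →
               Σ (Fin n) λ a → T (A 𝓜 u a) × (∀ b → T (A 𝓜 u b) → b ≡ a)
    partition : ∀ i u v w → IsBinEntry (entry ε i) u v w →
               ∀ x → (T (F 𝓜 i x) × ¬ T (S 𝓜 i x)) ⊎ (¬ T (F 𝓜 i x) × T (S 𝓜 i x))
    halfF    : ∀ i u v w → IsBinEntry (entry ε i) u v w → Half (F 𝓜 i)
    uvF      : ∀ i u v w → IsBinEntry (entry ε i) u v w →
               ∀ x → T (A 𝓜 u x) ⊎ T (A 𝓜 v x) → T (F 𝓜 i x)
    wS       : ∀ i u v w → IsBinEntry (entry ε i) u v w →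
               ∀ x → T (A 𝓜 w x) → T (S 𝓜 i x)

LinkHolds : ∀ {m n} → Structure m n → Fin m → Var → Var → Set
LinkHolds {n = n} 𝓜 i u w =
  (∀ y → T (A 𝓜 w y) → ∃ λ x → T (M 𝓜 i x y)) ×
  (∀ x y → T (M 𝓜 i x y) → T (A 𝓜 u x) × T (A 𝓜 w y))

{-# OPTIONS --safe #-}
-- Since the entry is binary, S_i is the complement of F_i and so has exactly half the elements;
-- it contains A_w and avoids A_u and A_v. Each formula describes a set obtained from S_i by
-- removing a subset of S_i (the M_i-successors of x, resp. x itself) and adding a set disjoint
-- from S_i (A_v, resp. the M_i-predecessors of x), so it is half-sized iff the two have equal size.
-- For (ii) this says that every element of A_w has exactly one M_i-predecessor; by φ_link it has
-- at least one, and only elements of A_w have predecessors.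
module Submission where

open import Defs
open import Data.Nat using (ℕ; zero; suc; _+_; _*_; pred)
open import Data.Nat.Properties using (+-suc; +-identityʳ; +-cancelˡ-≡; *-cancelˡ-≡)
open import Data.Bool using (Bool; true; false; _∧_; _∨_; not; T)
open import Data.Bool.Properties using (T-≡; T-∧)
open import Data.Fin using (Fin; zero; suc)
open import Data.Fin.Properties using (suc-injective)
open import Data.Product using (Σ; _×_; _,_; proj₁; proj₂)
open import Data.Sum using (inj₁; inj₂)
open import Data.Empty using (⊥-elim)
open import Function.Bundles using (_⇔_; mk⇔; Equivalence)
open import Function.Properties.Equivalence using () renaming (trans to ⇔-trans)
open import Relation.Nullary using (¬_)
open import Relation.Nullary.Decidable using (toWitness; fromWitness)
open import Relation.Binary.PropositionalEquality using (_≡_; refl; sym; trans; cong; subst; module ≡-Reasoning)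

open Equivalence using (to; from)

∀-cong-⇔ : ∀ {a r p q} {A : Set a} {R : A → Set r} {P : A → Set p} {Q : A → Set q} →
           (∀ x → R x → P x ⇔ Q x) → (∀ x → R x → P x) ⇔ (∀ x → R x → Q x)
∀-cong-⇔ P⇔Q = mk⇔ (λ H x r → to (P⇔Q x r) (H x r)) (λ H x r → from (P⇔Q x r) (H x r))

count-cong : ∀ {n} {p q : Fin n → Bool} → (∀ y → p y ≡ q y) → count p ≡ count q
count-cong {zero}  p≡q = refl
count-cong {suc n} p≡q rewrite p≡q zero = cong (_ +_) (count-cong (λ y → p≡q (suc y)))

count≡0⇒∅ : ∀ {n} (p : Fin n → Bool) → count p ≡ 0 → ∀ y → ¬ T (p y)
count≡0⇒∅ {suc n} p c y py with p zero in eq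
count≡0⇒∅ {suc n} p () y py       | true
count≡0⇒∅ {suc n} p c zero py     | false = subst T eq py
count≡0⇒∅ {suc n} p c (suc y) py  | false = count≡0⇒∅ (λ z → p (suc z)) c y py

∅⇒count≡0 : ∀ {n} (p : Fin n → Bool) → (∀ y → ¬ T (p y)) → count p ≡ 0
∅⇒count≡0 {zero}  p ∅ = refl
∅⇒count≡0 {suc n} p ∅ with p zero in eq
... | true  = ⊥-elim (∅ zero (from T-≡ eq))
... | false = ∅⇒count≡0 (λ y → p (suc y)) (λ y → ∅ (suc y))

count≡1⇒unique : ∀ {n} (p : Fin n → Bool) → count p ≡ 1 →
                 ∀ a b → T (p a) → T (p b) → a ≡ b
count≡1⇒unique {suc n} p c a b pa pb with p zero in eq
count≡1⇒unique p c zero    zero    pa pb | true  = refl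
count≡1⇒unique p c zero    (suc b) pa pb | true  = ⊥-elim (count≡0⇒∅ _ (cong pred c) b pb)
count≡1⇒unique p c (suc a) b       pa pb | true  = ⊥-elim (count≡0⇒∅ _ (cong pred c) a pa)
count≡1⇒unique p c zero    b       pa pb | false = ⊥-elim (subst T eq pa)
count≡1⇒unique p c (suc a) zero    pa pb | false = ⊥-elim (subst T eq pb)
count≡1⇒unique p c (suc a) (suc b) pa pb | false = cong suc (count≡1⇒unique _ c a b pa pb)

unique⇒count≡1 : ∀ {n} (p : Fin n → Bool) (a : Fin n) → T (p a) →
                 (∀ b → T (p b) → b ≡ a) → count p ≡ 1
unique⇒count≡1 p zero pa unique rewrite to T-≡ pa =
  cong suc (∅⇒count≡0 _ λ y py → suc≢zero (unique (suc y) py))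
  where
  suc≢zero : ∀ {k} {y : Fin k} → ¬ suc y ≡ zero
  suc≢zero ()
unique⇒count≡1 p (suc a) pa unique with p zero in eq
... | true  with unique zero (from T-≡ eq)
...   | ()
unique⇒count≡1 p (suc a) pa unique | false =
  unique⇒count≡1 (λ y → p (suc y)) a pa (λ b pb → suc-injective (unique (suc b) pb))

count-∨ : ∀ {n} (p q : Fin n → Bool) → (∀ y → T (p y) → ¬ T (q y)) →
          count (λ y → p y ∨ q y) ≡ count p + count q
count-∨ {zero}  p q disjoint = refl
count-∨ {suc n} p q disjoint with p zero | q zero | disjoint zero
... | true  | true  | d = ⊥-elim (d _ _)
... | true  | false | _ = cong suc (count-∨ _ _ (λ y → disjoint (suc y)))
... | false | true  | _ = trans (cong suc (count-∨ _ _ (λ y → disjoint (suc y)))) (sym (+-suc _ _))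
... | false | false | _ = count-∨ _ _ (λ y → disjoint (suc y))

count-∧-not : ∀ {n} (s d : Fin n → Bool) → (∀ y → T (d y) → T (s y)) →
              count (λ y → s y ∧ not (d y)) + count d ≡ count s
count-∧-not {zero}  s d d⊆s = refl
count-∧-not {suc n} s d d⊆s with s zero | d zero | d⊆s zero
... | true  | true  | _ = trans (+-suc _ _) (cong suc (count-∧-not _ _ (λ y → d⊆s (suc y))))
... | true  | false | _ = cong suc (count-∧-not _ _ (λ y → d⊆s (suc y)))
... | false | true  | k = ⊥-elim (k _)
... | false | false | _ = count-∧-not _ _ (λ y → d⊆s (suc y))

count-∧-redundant : ∀ {n} (p q : Fin n → Bool) → (∀ y → T (p y) → T (q y)) →
                    count (λ y → p y ∧ q y) ≡ count p
count-∧-redundant p q p⊆q = count-cong λ y → absorb (p y) (q y) (p⊆q y)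
  where
  absorb : ∀ a b → (T a → T b) → a ∧ b ≡ a
  absorb true  true  _ = refl
  absorb true  false k = ⊥-elim (k _)
  absorb false _     _ = refl

count-not : ∀ {n} (p : Fin n → Bool) → count p + count (λ y → not (p y)) ≡ n
count-not {zero}  p = refl
count-not {suc n} p with p zero
... | true  = cong suc (count-not _)
... | false = trans (+-suc _ _) (cong suc (count-not _))

count-== : ∀ {n} (x : Fin n) → count (x ==_) ≡ 1
count-== x = unique⇒count≡1 (x ==_) x (fromWitness refl) (λ b x≡b → sym (toWitness x≡b))

Half-not : ∀ {n} (p : Fin n → Bool) → Half p → Half (λ y → not (p y))
Half-not {n} p half = trans (cong (2 *_) ∣¬p∣≡∣p∣) half
  where
  ∣¬p∣≡∣p∣ : count (λ y → not (p y)) ≡ count p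
  ∣¬p∣≡∣p∣ = +-cancelˡ-≡ (count p) _ _
    (trans (count-not p) (trans (sym half) (cong (count p +_) (+-identityʳ (count p)))))

Half-exchange : ∀ {n} (s d q : Fin n → Bool) → Half s →
                (∀ y → T (d y) → T (s y)) → (∀ y → T (q y) → ¬ T (s y)) →
                Half (λ y → (s y ∧ not (d y)) ∨ q y) ⇔ count q ≡ count d
Half-exchange {n} s d q half d⊆s q∩s≡∅ = mk⇔ ⇒ ⇐
  where
  open ≡-Reasoning
  rest : ℕ
  rest = count (λ y → s y ∧ not (d y))

  ∣exchanged∣ : count (λ y → (s y ∧ not (d y)) ∨ q y) ≡ rest + count q
  ∣exchanged∣ = count-∨ _ q λ y s∖d qy → q∩s≡∅ y qy (proj₁ (to T-∧ s∖d))

  ⇒ : Half (λ y → (s y ∧ not (d y)) ∨ q y) → count q ≡ count d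
  ⇒ h = +-cancelˡ-≡ rest _ _ (*-cancelˡ-≡ _ _ 2 (begin
    2 * (rest + count q)                          ≡⟨ cong (2 *_) ∣exchanged∣ ⟨
    2 * count (λ y → (s y ∧ not (d y)) ∨ q y)     ≡⟨ h ⟩
    n                                             ≡⟨ half ⟨
    2 * count s                                   ≡⟨ cong (2 *_) (count-∧-not s d d⊆s) ⟨
    2 * (rest + count d)                          ∎))

  ⇐ : count q ≡ count d → Half (λ y → (s y ∧ not (d y)) ∨ q y)
  ⇐ ∣q∣≡∣d∣ = begin
    2 * count (λ y → (s y ∧ not (d y)) ∨ q y)     ≡⟨ cong (2 *_) ∣exchanged∣ ⟩
    2 * (rest + count q)                          ≡⟨ cong (λ k → 2 * (rest + k)) ∣q∣≡∣d∣ ⟩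
    2 * (rest + count d)                          ≡⟨ cong (2 *_) (count-∧-not s d d⊆s) ⟩
    2 * count s                                   ≡⟨ half ⟩
    n                                             ∎

one-predecessor⇔backward-functional :
  ∀ {n} (R : Fin n → Fin n → Bool) (B : Fin n → Bool) →
  (∀ y → T (B y) → Σ (Fin n) λ x → T (R x y)) → (∀ x y → T (R x y) → T (B y)) →
  (∀ y → T (B y) → count (λ x → R x y) ≡ 1) ⇔ (∀ y x x′ → T (R x y) → T (R x′ y) → x ≡ x′)
one-predecessor⇔backward-functional R B has-pred R⊆B = mk⇔ ⇒ ⇐
  where
  ⇒ : (∀ y → T (B y) → count (λ x → R x y) ≡ 1) → ∀ y x x′ → T (R x y) → T (R x′ y) → x ≡ x′
  ⇒ single y x x′ Rxy Rx′y = count≡1⇒unique (λ z → R z y) (single y (R⊆B x y Rxy)) x x′ Rxy Rx′y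

  ⇐ : (∀ y x x′ → T (R x y) → T (R x′ y) → x ≡ x′) → ∀ y → T (B y) → count (λ x → R x y) ≡ 1
  ⇐ functional y By with has-pred y By
  ... | x , Rxy = unique⇒count≡1 (λ z → R z y) x Rxy (λ x′ Rx′y → functional y x′ x Rx′y Rxy)

module _ {m n} {ε : System m} {𝓜 : Structure m n} (wp : WellPrepared ε 𝓜)
         {i u v w} (bin : IsBinEntry (entry ε i) u v w) where
  open WellPrepared wp

  private
    S≡not-F : ∀ y → S 𝓜 i y ≡ not (F 𝓜 i y)
    S≡not-F y with F 𝓜 i y | S 𝓜 i y | partition i u v w bin y
    ... | true  | false | _              = refl
    ... | false | true  | _              = refl
    ... | true  | true  | inj₁ (_ , ¬s)  = ⊥-elim (¬s _)
    ... | true  | true  | inj₂ (¬f , _)  = ⊥-elim (¬f _)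
    ... | false | false | inj₁ (f , _)   = ⊥-elim f
    ... | false | false | inj₂ (_ , s)   = ⊥-elim s

    F⇒¬S : ∀ y → T (F 𝓜 i y) → ¬ T (S 𝓜 i y)
    F⇒¬S y Fy Sy rewrite S≡not-F y | to T-≡ Fy = Sy

    Half-S : Half (S 𝓜 i)
    Half-S = trans (cong (2 *_) (count-cong S≡not-F)) (Half-not (F 𝓜 i) (halfF i u v w bin))

  Half⇔successor-count : ∀ x → (∀ y → T (M 𝓜 i x y) → T (A 𝓜 w y)) →
    Half (λ y → (S 𝓜 i y ∧ not (M 𝓜 i x y)) ∨ A 𝓜 v y)
      ⇔ count (λ y → M 𝓜 i x y ∧ A 𝓜 w y) ≡ count (A 𝓜 v)
  Half⇔successor-count x M⇒Aw = mk⇔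
    (λ half → trans ∣successors∣ (sym (to exchange half)))
    (λ ∣successors∣≡∣Av∣ → from exchange (sym (trans (sym ∣successors∣) ∣successors∣≡∣Av∣)))
    where
    exchange : Half (λ y → (S 𝓜 i y ∧ not (M 𝓜 i x y)) ∨ A 𝓜 v y) ⇔ count (A 𝓜 v) ≡ count (M 𝓜 i x)
    exchange = Half-exchange (S 𝓜 i) (M 𝓜 i x) (A 𝓜 v) Half-S
                 (λ y Mxy → wS i u v w bin y (M⇒Aw y Mxy))
                 (λ y Avy → F⇒¬S y (uvF i u v w bin y (inj₂ Avy)))
    ∣successors∣ : count (λ y → M 𝓜 i x y ∧ A 𝓜 w y) ≡ count (M 𝓜 i x)
    ∣successors∣ = count-∧-redundant (M 𝓜 i x) (A 𝓜 w) M⇒Aw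

  Half⇔predecessor-count≡1 : ∀ x → T (A 𝓜 w x) → (∀ y → T (M 𝓜 i y x) → T (A 𝓜 u y)) →
    Half (λ y → (S 𝓜 i y ∧ not (x == y)) ∨ M 𝓜 i y x) ⇔ count (λ y → M 𝓜 i y x) ≡ 1
  Half⇔predecessor-count≡1 x Awx M⇒Au =
    subst (λ k → Half (λ y → (S 𝓜 i y ∧ not (x == y)) ∨ M 𝓜 i y x) ⇔ count (λ y → M 𝓜 i y x) ≡ k)
          (count-== x)
      (Half-exchange (S 𝓜 i) (x ==_) (λ y → M 𝓜 i y x) Half-S
         (λ y x≡y → subst (λ z → T (S 𝓜 i z)) (toWitness x≡y) (wS i u v w bin x Awx))
         (λ y Myx → F⇒¬S y (uvF i u v w bin y (inj₁ (M⇒Au y Myx)))))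

lemma8 : ∀ {m n : ℕ} (ε : System m) (i : Fin m) (u v w : Var) →
         entry ε i ≡ mul u v w →
         (𝓜 : Structure m n) → WellPrepared ε 𝓜 → LinkHolds 𝓜 i u w →
         ((∀ x → T (A 𝓜 u x) →
             Half (λ y → (S 𝓜 i y ∧ not (M 𝓜 i x y)) ∨ A 𝓜 v y))
           ⇔ (∀ x → T (A 𝓜 u x) →
             count (λ y → M 𝓜 i x y ∧ A 𝓜 w y) ≡ count (A 𝓜 v)))
         ×
         ((∀ x → T (A 𝓜 w x) →
             Half (λ y → (S 𝓜 i y ∧ not (x == y)) ∨ M 𝓜 i y x))
           ⇔ (∀ y x x′ → T (M 𝓜 i x y) → T (M 𝓜 i x′ y) → x ≡ x′))
lemma8 ε i u v w e 𝓜 wp (has-pred , M⊆Au×Aw) =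
    ∀-cong-⇔ (λ x _ → Half⇔successor-count wp bin x (λ y Mxy → proj₂ (M⊆Au×Aw x y Mxy)))
  , ⇔-trans
      (∀-cong-⇔ λ x Awx → Half⇔predecessor-count≡1 wp bin x Awx (λ y Myx → proj₁ (M⊆Au×Aw y x Myx)))
      (one-predecessor⇔backward-functional (M 𝓜 i) (A 𝓜 w) has-pred (λ x y Mxy → proj₂ (M⊆Au×Aw x y Mxy)))
  where
  bin : IsBinEntry (entry ε i) u v w
  bin = inj₂ e
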